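{- Let $\pi\in\mathbf I_n(3412)$ and $\Psi(\pi)=d_1\cdots d_n$. For each $1\le i\le n-2$, the word $\pi_i\pi_{i+1}\pi_{i+2}$ is order-isomorphic to the pattern determined by $d_id_{i+1}d_{i+2}$ as follows: $HHH\to123$, $HHU\to123$, $HHD\to231$; $HUH\to132$, $HUU\to132$, $HUD\to132$; $HDH\to213$, $HDU\to213$, $HDD\to321$; $UHH\to312$, $UHU\to312$, $UHD\to321$; $UUH\to321$, $UUU\to321$, $UUD\to321$; $UDH\to213$, $UDU\to213$, $UDD\to321$; $DHH\to123$, $DHU\to123$, $DHD\to231$; $DUH\to132$, $DUU\to132$, $DUD\to132$; $DDH\to213$, $DDU\to213$, $DDD\to321$.
   Context: $\mathbf I_n(3412)$ is the set of involutions of $\{1,\dots,n\}$ with no subsequence order-isomorphic to $3412$. For an involution $\pi$, $\Psi(\pi)$ is the Motzkin path $d_1\cdots d_n$ (steps $U=(1,1)$, $D=(1,-1)$, $H=(1,0)$) with $d_i=H$ if $i$ is a fixed point, $d_i=U$ if $i$ is the smaller element of a 2-cycle, $d_i=D$ if $i$ is the larger element of a 2-cycle. -}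

module Defs where

open import Data.Nat using (ℕ; suc)
open import Data.Fin using (Fin; toℕ; _<_)
open import Data.Fin.Properties using (<-cmp)
open import Data.Product using (Σ; ∃; _×_; _,_)
open import Relation.Binary.Definitions using (tri<; tri≈; tri>)
open import Relation.Binary.PropositionalEquality using (_≡_)
open import Relation.Nullary using (¬_)

-- A permutation-word on {1..n}, encoded 0-based as a map Fin n → Fin n
-- (position i ↦ value π i).  An involution: π ∘ π = id (this already makes
-- π a bijection).
IsInvolution : {n : ℕ} → (Fin n → Fin n) → Set
IsInvolution π = ∀ i → π (π i) ≡ i

Contains3412 : {n : ℕ} → (Fin n → Fin n) → Set
Contains3412 {n} π =
  Σ (Fin n) λ i → Σ (Fin n) λ j → Σ (Fin n) λ k → Σ (Fin n) λ l →
    (i < j) × (j < k) × (k < l) ×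
    (π k < π l) × (π l < π i) × (π i < π j)

Avoids3412 : {n : ℕ} → (Fin n → Fin n) → Set
Avoids3412 π = ¬ Contains3412 π

data Step : Set where
  U D H : Step

Ψ : {n : ℕ} → (Fin n → Fin n) → Fin n → Step
Ψ π i with <-cmp i (π i)
... | tri< _ _ _ = U
... | tri≈ _ _ _ = H
... | tri> _ _ _ = D

data Pat3 : Set where
  p123 p132 p213 p231 p312 p321 : Pat3

OrderIso3 : {n : ℕ} → Fin n → Fin n → Fin n → Pat3 → Set
OrderIso3 a b c p123 = (a < b) × (b < c)
OrderIso3 a b c p132 = (a < c) × (c < b)
OrderIso3 a b c p213 = (b < a) × (a < c)
OrderIso3 a b c p231 = (c < a) × (a < b)
OrderIso3 a b c p312 = (b < c) × (c < a)
OrderIso3 a b c p321 = (c < b) × (b < a)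

table : Step → Step → Step → Pat3
table H H H = p123
table H H U = p123
table H H D = p231
table H U H = p132
table H U U = p132
table H U D = p132
table H D H = p213
table H D U = p213
table H D D = p321
table U H H = p312
table U H U = p312
table U H D = p321
table U U H = p321
table U U U = p321
table U U D = p321
table U D H = p213
table U D U = p213
table U D D = p321
table D H H = p123
table D H U = p123
table D H D = p231
table D U H = p132
table D U U = p132
table D U D = p132
table D D H = p213
table D D U = p213
table D D D = p321

module Submission where

-- Read Ψ(π) as a system of arcs: a 2-cycle (x, π x) is an arc,
-- a fixed point is an isolated vertex.  In an involution, an occurrence of
-- 3412 is exactly a pair of crossing arcs, so avoiding 3412 means that arcs
-- nest (nestAbove, nestBelow).  From this we get, for adjacent positions x,
-- x+1, the local rule (adjacentOrder)
--     π x < π (x+1)   iff   d_x ≠ U and d_{x+1} ≠ D,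
-- and, when π_i π_{i+1} π_{i+2} is a peak or a valley, the rule (outerOrder)
--     π i < π (i+2)   iff   d_{i+1} ≠ H.
-- Three distinct values are ordered as one pattern determined by these three
-- comparisons (realize), and the table of Theorem 4.1 is exactly that
-- assignment (table-shape).

open import Defs
open import Data.Nat using (ℕ; suc)
open import Data.Fin using (Fin; toℕ; _<_; _≤_)
open import Data.Fin.Properties using (<-cmp; <-irrefl; ≤∧≢⇒<; ≤-reflexive)
import Data.Nat.Properties as ℕ
open import Data.Bool using (Bool; true; false)
open import Data.Product using (_,_)
open import Data.Empty using (⊥; ⊥-elim)
open import Relation.Nullary using (¬_)
open import Relation.Binary.Definitions using (tri<; tri≈; tri>)
open import Relation.Binary.PropositionalEquality
  using (_≡_; _≢_; refl; sym; trans; cong; subst; subst₂)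

private
  variable
    n : ℕ
    a b c p q r s x x′ y z : Fin n

<-by-elimination : a ≢ b → ¬ (b < a) → a < b
<-by-elimination a≢b b≮a = ≤∧≢⇒< (ℕ.≮⇒≥ b≮a) a≢b

Ordered : Bool → Fin n → Fin n → Set
Ordered true  a b = a < b
Ordered false a b = b < a

shape : Bool → Bool → Bool → Pat3
shape true  true  _     = p123
shape false false _     = p321
shape true  false true  = p132
shape true  false false = p231
shape false true  true  = p213
shape false true  false = p312

realize : ∀ {up₁ up₂ up₃} → Ordered up₁ a b → Ordered up₂ b c →
          (up₁ ≢ up₂ → Ordered up₃ a c) → OrderIso3 a b c (shape up₁ up₂ up₃)
realize {up₁ = true}  {true}          a<b b<c _   = a<b , b<c
realize {up₁ = false} {false}         b<a c<b _   = c<b , b<a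
realize {up₁ = true}  {false} {true}  _   c<b a<c = a<c (λ ()) , c<b
realize {up₁ = true}  {false} {false} a<b _   c<a = c<a (λ ()) , a<b
realize {up₁ = false} {true}  {true}  b<a _   a<c = b<a , a<c (λ ())
realize {up₁ = false} {true}  {false} _   b<c c<a = b<c , c<a (λ ())

-- π x < π (x+1) exactly when d_x ≠ U and d_{x+1} ≠ D.
ascent : Step → Step → Bool
ascent U _ = false
ascent _ D = false
ascent _ _ = true

-- In a peak or valley, π i < π (i+2) exactly when d_{i+1} ≠ H.
moves : Step → Bool
moves H = false
moves _ = true

table-shape : ∀ s t u → table s t u ≡ shape (ascent s t) (ascent t u) (moves t)
table-shape H H H = refl
table-shape H H U = refl
table-shape H H D = refl
table-shape H U H = refl
table-shape H U U = refl
table-shape H U D = refl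
table-shape H D H = refl
table-shape H D U = refl
table-shape H D D = refl
table-shape U H H = refl
table-shape U H U = refl
table-shape U H D = refl
table-shape U U H = refl
table-shape U U U = refl
table-shape U U D = refl
table-shape U D H = refl
table-shape U D U = refl
table-shape U D D = refl
table-shape D H H = refl
table-shape D H U = refl
table-shape D H D = refl
table-shape D U H = refl
table-shape D U U = refl
table-shape D U D = refl
table-shape D D H = refl
table-shape D D U = refl
table-shape D D D = refl

Adjacent : Fin n → Fin n → Set
Adjacent x y = toℕ y ≡ suc (toℕ x)

adjacent⇒< : Adjacent x y → x < y
adjacent⇒< x~y = ℕ.≤-reflexive (sym x~y)

below-next : Adjacent x y → z < y → z ≤ x
below-next x~y z<y = ℕ.≤-pred (ℕ.≤-trans z<y (ℕ.≤-reflexive x~y))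

above-previous : Adjacent x y → x < z → y ≤ z
above-previous x~y x<z = ℕ.≤-trans (ℕ.≤-reflexive x~y) x<z

data StepView (x v : Fin n) : Step → Set where
  rise  : x < v → StepView x v U
  fixed : v ≡ x → StepView x v H
  fall  : v < x → StepView x v D

stepView : (π : Fin n → Fin n) (x : Fin n) → StepView x (π x) (Ψ π x)
stepView π x with <-cmp x (π x)
... | tri< x<πx _ _ = rise x<πx
... | tri≈ _ x≡πx _ = fixed (sym x≡πx)
... | tri> _ _ πx<x = fall πx<x

module Involution {π : Fin n → Fin n} (inv : IsInvolution π) where

  partner : π x ≡ y → π y ≡ x
  partner {x = x} refl = inv x

  injective : π x ≡ π y → x ≡ y
  injective {x = x} {y = y} e = trans (sym (inv x)) (trans (cong π e) (inv y))

  -- If x rises and its successor y does not fall, then π x lies beyond y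
  -- (π x = y would force π y = x < y).
  rise-past : Adjacent x y → x < π x → y ≤ π y → y < π x
  rise-past {x = x} {y = y} x~y x<πx y≤πy = ≤∧≢⇒< (above-previous x~y x<πx) y≢πx
    where
      y≢πx : y ≢ π x
      y≢πx y≡πx = <-irrefl refl
        (subst (x <_) (partner (sym y≡πx)) (ℕ.<-≤-trans (adjacent⇒< x~y) y≤πy))

  fall-below : Adjacent x y → π y < y → π x ≤ x → π y < x
  fall-below {x = x} {y = y} x~y πy<y πx≤x = ≤∧≢⇒< (below-next x~y πy<y) πy≢x
    where
      πy≢x : π y ≢ x
      πy≢x πy≡x = <-irrefl refl
        (subst (_< y) (partner πy≡x) (ℕ.≤-<-trans πx≤x (adjacent⇒< x~y)))

-- Avoiding 3412 means that the arcs of π never cross, hence they nest.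
module Avoiding {π : Fin n → Fin n} (inv : IsInvolution π) (av : Avoids3412 π) where
  open Involution {π = π} inv

  noCrossing : p < q → q < r → r < s → π p ≡ r → π q ≡ s → ⊥
  noCrossing {p = p} {q} {r} {s} p<q q<r r<s πp≡r πq≡s =
    av (p , q , r , s , p<q , q<r , r<s ,
        subst₂ _<_ (sym (partner πp≡r)) (sym (partner πq≡s)) p<q ,
        subst₂ _<_ (sym (partner πq≡s)) (sym πp≡r) q<r ,
        subst₂ _<_ (sym πp≡r) (sym πq≡s) r<s)

  nestAbove : x < y → y < x′ → π x ≡ x′ → π y < x′
  nestAbove {x = x} {y = y} {x′ = x′} x<y y<x′ πx≡x′ = <-by-elimination πy≢x′ x′≮πy
    where
      πy≢x′ : π y ≢ x′
      πy≢x′ πy≡x′ = <-irrefl (injective (trans πx≡x′ (sym πy≡x′))) x<y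
      x′≮πy : ¬ (x′ < π y)
      x′≮πy x′<πy = noCrossing x<y y<x′ x′<πy πx≡x′ refl

  nestBelow : x′ < y → y < x → π x ≡ x′ → x′ < π y
  nestBelow {x′ = x′} {y = y} {x = x} x′<y y<x πx≡x′ = <-by-elimination x′≢πy πy≮x′
    where
      x′≢πy : x′ ≢ π y
      x′≢πy x′≡πy = <-irrefl (sym (injective (trans πx≡x′ x′≡πy))) y<x
      πy≮x′ : ¬ (π y < x′)
      πy≮x′ πy<x′ = noCrossing πy<x′ x′<y y<x (partner refl) (partner πx≡x′)

  adjacentOrder : Adjacent x y → Ordered (ascent (Ψ π x) (Ψ π y)) (π x) (π y)
  adjacentOrder {x = x} {y = y} x~y = compare (stepView π x) (stepView π y)
    where
      ascending : π x ≤ x → y ≤ π y → π x < π y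
      ascending πx≤x y≤πy = ℕ.≤-<-trans πx≤x (ℕ.<-≤-trans (adjacent⇒< x~y) y≤πy)

      compare : ∀ {s t} → StepView x (π x) s → StepView y (π y) t →
                Ordered (ascent s t) (π x) (π y)
      compare (fixed πx≡x) (fixed πy≡y) = ascending (≤-reflexive πx≡x) (≤-reflexive (sym πy≡y))
      compare (fixed πx≡x) (rise y<πy)  = ascending (≤-reflexive πx≡x) (ℕ.<⇒≤ y<πy)
      compare (fall πx<x)  (fixed πy≡y) = ascending (ℕ.<⇒≤ πx<x) (≤-reflexive (sym πy≡y))
      compare (fall πx<x)  (rise y<πy)  = ascending (ℕ.<⇒≤ πx<x) (ℕ.<⇒≤ y<πy)
      compare (rise x<πx)  (fixed πy≡y) =
        subst (_< π x) (sym πy≡y) (rise-past x~y x<πx (≤-reflexive (sym πy≡y)))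
      compare (rise x<πx)  (rise y<πy)  =
        nestAbove (adjacent⇒< x~y) (rise-past x~y x<πx (ℕ.<⇒≤ y<πy)) refl
      compare (rise x<πx)  (fall πy<y)  = ℕ.≤-<-trans (below-next x~y πy<y) x<πx
      compare (fixed πx≡x) (fall πy<y)  =
        subst (π y <_) (sym πx≡x) (fall-below x~y πy<y (≤-reflexive πx≡x))
      compare (fall πx<x)  (fall πy<y)  =
        nestBelow (fall-below x~y πy<y (ℕ.<⇒≤ πx<x)) (adjacent⇒< x~y) refl

  module Window {i j k : Fin n} (i~j : Adjacent i j) (j~k : Adjacent j k) where

    i<k : i < k
    i<k = ℕ.<-trans (adjacent⇒< i~j) (adjacent⇒< j~k)

    πi≢πk : π i ≢ π k
    πi≢πk πi≡πk = <-irrefl (injective πi≡πk) i<k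

    risingMiddle : j < π j → π i ≤ i → π i < π k
    risingMiddle j<πj πi≤i = <-by-elimination πi≢πk πk≮πi
      where
        πk≮πi : ¬ (π k < π i)
        πk≮πi πk<πi = <-irrefl refl (ℕ.<-≤-trans πj<k (above-previous j~k j<πj))
          where
            πk<j : π k < j
            πk<j = ℕ.<-trans (ℕ.<-≤-trans πk<πi πi≤i) (adjacent⇒< i~j)
            πj<k : π j < k
            πj<k = nestAbove πk<j (adjacent⇒< j~k) (inv k)

    fallingMiddle : π j < j → k ≤ π k → π i < π k
    fallingMiddle πj<j k≤πk = <-by-elimination πi≢πk πk≮πi
      where
        πk≮πi : ¬ (π k < π i)
        πk≮πi πk<πi = <-irrefl refl (ℕ.≤-<-trans (below-next i~j πj<j) i<πj)
          where
            j<πi : j < π i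
            j<πi = ℕ.<-trans (adjacent⇒< j~k) (ℕ.≤-<-trans k≤πk πk<πi)
            i<πj : i < π j
            i<πj = nestBelow (adjacent⇒< i~j) j<πi (inv i)

    fixedMiddleBelow : π j ≡ j → π i ≤ i → π k < k → π k < π i
    fixedMiddleBelow πj≡j πi≤i πk<k = nestBelow πk<i i<k refl
      where
        πk≤i : π k ≤ i
        πk≤i = below-next i~j (fall-below j~k πk<k (≤-reflexive πj≡j))
        πk≢i : π k ≢ i
        πk≢i πk≡i = <-irrefl refl (ℕ.<-≤-trans i<k (subst (_≤ i) (partner πk≡i) πi≤i))
        πk<i : π k < i
        πk<i = ≤∧≢⇒< πk≤i πk≢i

    fixedMiddleAbove : π j ≡ j → i < π i → k ≤ π k → π k < π i
    fixedMiddleAbove πj≡j i<πi k≤πk = nestAbove i<k k<πi refl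
      where
        k≤πi : k ≤ π i
        k≤πi = above-previous j~k (rise-past i~j i<πi (≤-reflexive (sym πj≡j)))
        k≢πi : k ≢ π i
        k≢πi k≡πi = <-irrefl refl (ℕ.<-≤-trans i<k (subst (k ≤_) (partner (sym k≡πi)) k≤πk))
        k<πi : k < π i
        k<πi = ≤∧≢⇒< k≤πi k≢πi

  outerOrder : {i j k : Fin n} → Adjacent i j → Adjacent j k →
               ascent (Ψ π i) (Ψ π j) ≢ ascent (Ψ π j) (Ψ π k) →
               Ordered (moves (Ψ π j)) (π i) (π k)
  outerOrder {i = i} {j} {k} i~j j~k = compare (stepView π i) (stepView π j) (stepView π k)
    where
      open Window i~j j~k

      compare : ∀ {s t u} → StepView i (π i) s → StepView j (π j) t → StepView k (π k) u →
                ascent s t ≢ ascent t u → Ordered (moves t) (π i) (π k)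
      compare (fixed πi≡i) (rise j<πj)  _            _ = risingMiddle j<πj (≤-reflexive πi≡i)
      compare (fall πi<i)  (rise j<πj)  _            _ = risingMiddle j<πj (ℕ.<⇒≤ πi<i)
      compare _            (fall πj<j)  (fixed πk≡k) _ = fallingMiddle πj<j (≤-reflexive (sym πk≡k))
      compare _            (fall πj<j)  (rise k<πk)  _ = fallingMiddle πj<j (ℕ.<⇒≤ k<πk)
      compare (rise i<πi)  (fixed πj≡j) (fixed πk≡k) _ =
        fixedMiddleAbove πj≡j i<πi (≤-reflexive (sym πk≡k))
      compare (rise i<πi)  (fixed πj≡j) (rise k<πk)  _ =
        fixedMiddleAbove πj≡j i<πi (ℕ.<⇒≤ k<πk)
      compare (fixed πi≡i) (fixed πj≡j) (fall πk<k)  _ =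
        fixedMiddleBelow πj≡j (≤-reflexive πi≡i) πk<k
      compare (fall πi<i)  (fixed πj≡j) (fall πk<k)  _ =
        fixedMiddleBelow πj≡j (ℕ.<⇒≤ πi<i) πk<k
      compare (rise _)  (rise _)  _         monotone = ⊥-elim (monotone refl)
      compare (rise _)  (fall _)  (fall _)  monotone = ⊥-elim (monotone refl)
      compare (fixed _) (fall _)  (fall _)  monotone = ⊥-elim (monotone refl)
      compare (fall _)  (fall _)  (fall _)  monotone = ⊥-elim (monotone refl)
      compare (rise _)  (fixed _) (fall _)  monotone = ⊥-elim (monotone refl)
      compare (fixed _) (fixed _) (fixed _) monotone = ⊥-elim (monotone refl)
      compare (fixed _) (fixed _) (rise _)  monotone = ⊥-elim (monotone refl)
      compare (fall _)  (fixed _) (fixed _) monotone = ⊥-elim (monotone refl)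
      compare (fall _)  (fixed _) (rise _)  monotone = ⊥-elim (monotone refl)

theorem4p1 : (n : ℕ) (π : Fin n → Fin n) → IsInvolution π → Avoids3412 π →
    (i j k : Fin n) → toℕ j ≡ suc (toℕ i) → toℕ k ≡ suc (toℕ j) →
    OrderIso3 (π i) (π j) (π k) (table (Ψ π i) (Ψ π j) (Ψ π k))
theorem4p1 n π inv av i j k i~j j~k =
  subst (OrderIso3 (π i) (π j) (π k)) (sym (table-shape (Ψ π i) (Ψ π j) (Ψ π k)))
    (realize (adjacentOrder i~j) (adjacentOrder j~k) (outerOrder i~j j~k))
  where open Avoiding inv av
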